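{- Let $n$ and $k$ be positive integers and $\alpha=(a_1,\dots,a_{n+k})\in[n]^{n+k}$. Let $(\pi_1,\dots,\pi_n)$ be the outcome of $(a_1,\dots,a_n)$ under the $(n-1)$-metered parking scheme, $\pi_i$ being the spot in which car $i$ parks. Then $\alpha$ is an $(n-1)$-metered $(n+k,n)$-parking function if and only if the nondecreasing rearrangement $a'_1\le\dots\le a'_n$ of $a_1,\dots,a_n$ satisfies $a'_i\le i$ for all $i\in[n]$ and $a_{n+i}\le \pi_{i \bmod n}$ for all $i\in[k]$, where $i\bmod n$ denotes the representative of $i$ modulo $n$ lying in $[n]$.
   Context: $[n]=\{1,\dots,n\}$. For a nonnegative integer $t$ and positive integers $m,n$, a preference list $\alpha=(a_1,\dots,a_m)\in[n]^m$ is processed by the $t$-metered parking scheme: there are $n$ spots $1,\dots,n$; cars $1,\dots,m$ arrive in order; car $i$ drives to spot $a_i$, parks there if it is unoccupied, and otherwise parks in the first unoccupied spot numbered greater than $a_i$; if there is none, the car fails to park. Immediately after car $j$ parks, car $j-t$ (if $j-t\ge1$) leaves, vacating its spot. $\alpha$ is a $t$-metered $(m,n)$-parking function if all $m$ cars park. (When $a'_i\le i$ for all $i\in[n]$, the first $n$ cars all park, so $\pi_1,\dots,\pi_n\in[n]$.) -}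

module Defs where

open import Data.Nat using (ℕ; zero; suc; _+_; _∸_; _≤_; _≟_)
open import Data.Nat.Properties using (≤-decTotalOrder)
open import Data.List using (List; []; _∷_; take; filter; applyUpTo; reverse; length)
open import Data.List.Membership.DecPropositional _≟_ using (_∈?_)
open import Data.List.Relation.Unary.All using (All)
open import Data.Maybe using (Maybe; just; nothing)
open import Data.Product using (_×_)
open import Relation.Nullary.Decidable using (¬?)
import Data.List.Sort

sortℕ : List ℕ → List ℕ
sortℕ = Data.List.Sort.sort ≤-decTotalOrder

spotsFrom : ℕ → ℕ → List ℕ
spotsFrom n a = applyUpTo (λ i → a + i) (suc n ∸ a)

firstFree : ℕ → List ℕ → ℕ → Maybe ℕ
firstFree n occ a with filter (λ s → ¬? (s ∈? occ)) (spotsFrom n a)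
... | []    = nothing
... | s ∷ _ = just s

-- t-metered parking scheme with n spots.
-- 'hist' is the list of spots where the cars so far parked, most recent first.
-- When a new car j arrives, the cars still parked are exactly the last t cars
-- (cars j-t, ..., j-1), since car i leaves right after car i+t parks.
runFrom : ℕ → ℕ → List ℕ → List ℕ → Maybe (List ℕ)
runFrom t n hist []       = just []
runFrom t n hist (a ∷ as) with firstFree n (take t hist) a
... | nothing = nothing
... | just s with runFrom t n (s ∷ hist) as
...   | nothing = nothing
...   | just ss = just (s ∷ ss)

outcome : ℕ → ℕ → List ℕ → Maybe (List ℕ)
outcome t n α = runFrom t n [] α

data Parks : Maybe (List ℕ) → Set where
  parks : ∀ ss → Parks (just ss)

IsMeteredPF : ℕ → ℕ → List ℕ → Set
IsMeteredPF t n α = All (λ a → 1 ≤ a × a ≤ n) α × Parks (outcome t n α)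

-- While the first n cars arrive no car has left, so they park in n distinct spots π_i ≥ a_i.
-- Hence π is a permutation of [n], and comparing the number of preferences ≥ i + 2 with the
-- number of spots ≥ i + 2 gives a'_(i+1) ≤ i + 1; this condition is therefore automatic once
-- the first n cars park.  Afterwards, when car n + i arrives, cars i + 1, …, n + i − 1 occupy
-- every spot except π_(i mod n), the one vacated by car i; so car n + i parks iff
-- a_(n+i) ≤ π_(i mod n), and it parks there, keeping the spots cycling through π.

module Submission where

open import Defs
open import Data.Nat using (ℕ; zero; suc; _+_; _*_; _∸_; _≤_; _<_; _≟_; _≤?_; z≤n; s≤s; NonZero)
open import Data.Nat.Properties
open import Data.Nat.DivMod using (_mod_; _%_; _/_; m≡m%n+[m/n]*n; m%n<n)
open import Data.Fin using (Fin; toℕ; _↑ʳ_) renaming (zero to fzero; suc to fsuc)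
open import Data.Fin.Properties using (toℕ<n; toℕ-fromℕ<)
open import Data.Vec using (Vec; []; _∷_; lookup; take; toList)
import Data.Vec as Vec
import Data.Vec.Properties as Vec
import Data.List
open import Data.List as List using (List; []; _∷_; length; _++_; _ʳ++_; _∷ʳ_; [_]; filter; reverse)
open import Data.List.Properties
  using (length-++; ++-assoc; ++-identityʳ; ++-ʳ++; ʳ++-defn; length-reverse; take-all; drop-all;
         filter-all; filter-accept; filter-reject; length-applyUpTo; length-removeAt′)
open import Data.List.Membership.Propositional using (_∈_; _∉_; _─_)
open import Data.List.Membership.Propositional.Properties
  using (∈-applyUpTo⁺; ∈-applyUpTo⁻; ∈-filter⁺; ∈-filter⁻; ∈-++⁺ˡ; ∈-++⁺ʳ)
open import Data.List.Membership.DecPropositional _≟_ using (_∈?_)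
open import Data.List.Relation.Unary.Any using (here; there; index)
import Data.List.Relation.Unary.Any.Properties as Any
open import Data.List.Relation.Unary.All as All using (All; []; _∷_)
import Data.List.Relation.Unary.All.Properties as All
open import Data.List.Relation.Unary.AllPairs as AllPairs using ([]; _∷_)
open import Data.List.Relation.Unary.Unique.Propositional using (Unique)
import Data.List.Relation.Unary.Unique.Propositional.Properties as Unique
open import Data.List.Relation.Unary.Linked as Linked using (Linked; []; [-]; _∷_)
open import Data.List.Relation.Unary.Linked.Properties using (Linked⇒All)
open import Data.List.Relation.Binary.Pointwise as Pointwise using (Pointwise; []; _∷_)
open import Data.List.Relation.Binary.Subset.Propositional using (_⊆_)
open import Data.List.Relation.Binary.Permutation.Propositional using (_↭_)
open import Data.List.Relation.Binary.Permutation.Propositional.Properties using (↭-length; filter-↭)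
import Data.List.Sort
open import Data.Maybe using (just; nothing)
open import Data.Product using (_×_; _,_; ∃; proj₁; proj₂)
open import Function.Base using (_∘_)
open import Data.Empty using (⊥-elim)
open import Level using (0ℓ)
open import Relation.Nullary using (¬_; yes; no)
open import Relation.Nullary.Decidable using (¬?; decidable-stable)
open import Relation.Binary.PropositionalEquality hiding ([_])
open import Function.Bundles using (_⇔_; mk⇔; Equivalence)
open import Function.Properties.Equivalence using (⇔-setoid) renaming (refl to ⇔-refl; trans to ⇔-trans)
open import Data.Product.Function.NonDependent.Propositional using (_×-⇔_)
import Relation.Binary.Reasoning.Setoid as SetoidReasoning

open Data.List.Sort ≤-decTotalOrder using (sort-↭; sort-↗)

spotsFrom⁻ : ∀ {n a x} → x ∈ spotsFrom n a → a ≤ x × x ≤ n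
spotsFrom⁻ {n} {a} x∈ with ∈-applyUpTo⁻ (a +_) x∈
... | i , i<len , refl with a ≤? suc n
...   | yes a≤1+n = m≤m+n a i , ≤-pred (subst (a + i <_) (m+[n∸m]≡n a≤1+n) (+-monoʳ-< a i<len))
...   | no a≰1+n = ⊥-elim (n≮0 (subst (i <_) (m≤n⇒m∸n≡0 (<⇒≤ (≰⇒> a≰1+n))) i<len))

spotsFrom⁺ : ∀ {n a x} → a ≤ x → x ≤ n → x ∈ spotsFrom n a
spotsFrom⁺ {n} {a} a≤x x≤n =
  subst (_∈ spotsFrom n a) (m+[n∸m]≡n a≤x) (∈-applyUpTo⁺ (a +_) (∸-monoˡ-< (s≤s x≤n) a≤x))

firstFree-just : ∀ {n occ a s} → firstFree n occ a ≡ just s → a ≤ s × s ≤ n × s ∉ occ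
firstFree-just {n} {occ} {a} {s} eq with filter (λ s → ¬? (s ∈? occ)) (spotsFrom n a) in free
firstFree-just () | []
firstFree-just {n} {occ} {a} {s} refl | _ ∷ _
  with s∈spots , s∉occ ← ∈-filter⁻ (λ s → ¬? (s ∈? occ)) {xs = spotsFrom n a}
                            (subst (s ∈_) (sym free) (here refl))
  = proj₁ (spotsFrom⁻ s∈spots) , proj₂ (spotsFrom⁻ s∈spots) , s∉occ

firstFree-nothing : ∀ {n occ a x} → firstFree n occ a ≡ nothing → a ≤ x → x ≤ n → x ∈ occ
firstFree-nothing {n} {occ} {a} {x} eq a≤x x≤n with filter (λ s → ¬? (s ∈? occ)) (spotsFrom n a) in free
... | _ ∷ _ with () ← eq
... | [] with x ∈? occ
...   | yes x∈occ = x∈occ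
...   | no x∉occ
  with () ← subst (x ∈_) free (∈-filter⁺ (λ s → ¬? (s ∈? occ)) (spotsFrom⁺ a≤x x≤n) x∉occ)

∈-─ : ∀ {A : Set} {x y : A} {ys} (x∈ys : x ∈ ys) → y ∈ ys → y ≢ x → y ∈ ys ─ x∈ys
∈-─ (here refl) (here refl) y≢x = ⊥-elim (y≢x refl)
∈-─ (here refl) (there y∈ys) _ = y∈ys
∈-─ (there x∈ys) (here refl) _ = here refl
∈-─ (there x∈ys) (there y∈ys) y≢x = there (∈-─ x∈ys y∈ys y≢x)

unique⊆⇒length≤ : ∀ {A : Set} {xs ys : List A} → Unique xs → xs ⊆ ys → length xs ≤ length ys
unique⊆⇒length≤ {xs = []} _ _ = z≤n
unique⊆⇒length≤ {xs = x ∷ xs} {ys} (x∉xs ∷ unique) xs⊆ys = begin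
  suc (length xs)          ≤⟨ s≤s (unique⊆⇒length≤ unique xs⊆ys─x) ⟩
  suc (length (ys ─ x∈ys)) ≡⟨ length-removeAt′ ys (index x∈ys) ⟨
  length ys                ∎
  where
  open ≤-Reasoning
  x∈ys : x ∈ ys
  x∈ys = xs⊆ys (here refl)
  xs⊆ys─x : xs ⊆ ys ─ x∈ys
  xs⊆ys─x y∈xs = ∈-─ x∈ys (xs⊆ys (there y∈xs)) (λ y≡x → All.lookup x∉xs y∈xs (sym y≡x))

length-spotsFrom : ∀ n a → length (spotsFrom n a) ≡ suc n ∸ a
length-spotsFrom n a = length-applyUpTo (a +_) (suc n ∸ a)

unique-bounded⇒length≤ : ∀ {n a} {xs : List ℕ} → Unique xs → All (λ x → a ≤ x × x ≤ n) xs →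
  length xs ≤ suc n ∸ a
unique-bounded⇒length≤ {n} {a} unique bounded = subst (_ ≤_) (length-spotsFrom n a)
  (unique⊆⇒length≤ unique λ x∈xs → let a≤x , x≤n = All.lookup bounded x∈xs in spotsFrom⁺ a≤x x≤n)

unique-bounded-covers : ∀ {n} {xs : List ℕ} → Unique xs → All (λ x → 1 ≤ x × x ≤ n) xs →
  length xs ≡ n → ∀ {z} → 1 ≤ z → z ≤ n → z ∈ xs
unique-bounded-covers {xs = xs} unique bounded length≡n {z} 1≤z z≤max =
  decidable-stable (z ∈? xs) λ z∉xs → <-irrefl length≡n
    (unique-bounded⇒length≤ (All.¬Any⇒All¬ xs z∉xs ∷ unique) ((1≤z , z≤max) ∷ bounded))

module _ {t n : ℕ} where

  parks-∷-just : ∀ {hist a as s} → firstFree n (List.take t hist) a ≡ just s →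
    Parks (runFrom t n hist (a ∷ as)) ⇔ Parks (runFrom t n (s ∷ hist) as)
  parks-∷-just {hist} {a} {as} {s} free rewrite free with runFrom t n (s ∷ hist) as
  ... | nothing = mk⇔ (λ ()) (λ ())
  ... | just ss = mk⇔ (λ _ → parks ss) (λ _ → parks (s ∷ ss))

  parks-∷-nothing : ∀ {hist a as} → firstFree n (List.take t hist) a ≡ nothing →
    ¬ Parks (runFrom t n hist (a ∷ as))
  parks-∷-nothing full rewrite full = λ ()

  runFrom-∷⁻ : ∀ {hist a as zs} → runFrom t n hist (a ∷ as) ≡ just zs →
    ∃ λ s → ∃ λ ss → firstFree n (List.take t hist) a ≡ just s
                   × runFrom t n (s ∷ hist) as ≡ just ss × zs ≡ s ∷ ss
  runFrom-∷⁻ {hist} {a} {as} eq with firstFree n (List.take t hist) a in free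
  ... | nothing with () ← eq
  ... | just s with runFrom t n (s ∷ hist) as in rest
  ...   | nothing with () ← eq
  ...   | just ss with refl ← eq = s , ss , refl , rest , refl

  parks-++ : ∀ {hist} as bs {ss} → runFrom t n hist as ≡ just ss →
    Parks (runFrom t n hist (as ++ bs)) ⇔ Parks (runFrom t n (ss ʳ++ hist) bs)
  parks-++ [] bs refl = mk⇔ (λ p → p) (λ p → p)
  parks-++ {hist} (a ∷ as) bs eq with runFrom-∷⁻ {hist} {a} {as} eq
  ... | s , ss , free , rest , refl = ⇔-trans (parks-∷-just {hist} {a} {as ++ bs} free) (parks-++ as bs rest)

  parks-++⁻ : ∀ {hist} as bs → Parks (runFrom t n hist (as ++ bs)) →
    ∃ λ ss → runFrom t n hist as ≡ just ss
  parks-++⁻ [] bs _ = [] , refl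
  parks-++⁻ {hist} (a ∷ as) bs p = from-firstFree (firstFree n (List.take t hist) a) refl
    where
    from-firstFree : ∀ m → firstFree n (List.take t hist) a ≡ m →
      ∃ λ ss → runFrom t n hist (a ∷ as) ≡ just ss
    from-firstFree nothing full = ⊥-elim (parks-∷-nothing {hist} {a} {as ++ bs} full p)
    from-firstFree (just s) free
      with parks-++⁻ {s ∷ hist} as bs (Equivalence.to (parks-∷-just {hist} {a} {as ++ bs} free) p)
    ... | ss , rest rewrite free | rest = s ∷ ss , refl

  -- With at most t + 1 cars in total no car has left, so all of hist is occupied.
  runFrom-before-departures : ∀ {hist} as {ss} → length hist + length as ≤ suc t →
    runFrom t n hist as ≡ just ss →
    All (_∉ hist) ss × Unique ss × Pointwise _≤_ as ss × All (_≤ n) ss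
  runFrom-before-departures [] _ refl = [] , [] , [] , []
  runFrom-before-departures {hist} (a ∷ as) room eq with runFrom-∷⁻ {hist} {a} {as} eq
  ... | s , ss , free , rest , refl =
    let a≤s , s≤n , s∉occupied = firstFree-just free
        ss∉s∷hist , unique , as≤ss , ss≤n = runFrom-before-departures as room′ rest
    in subst (s ∉_) (take-all t hist hist≤t) s∉occupied ∷ All.map (_∘ there) ss∉s∷hist
     , All.map (λ s∉ → s∉ ∘ here ∘ sym) ss∉s∷hist ∷ unique
     , a≤s ∷ as≤ss
     , s≤n ∷ ss≤n
    where
    room′ : length (s ∷ hist) + length as ≤ suc t
    room′ = subst (_≤ suc t) (+-suc (length hist) (length as)) room
    hist≤t : length hist ≤ t
    hist≤t = ≤-pred (≤-trans (s≤s (m≤m+n (length hist) (length as))) room′)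

record Arrangement (n : ℕ) (p : List ℕ) : Set where
  field
    length≡ : length p ≡ n
    unique : Unique p
    covers : ∀ {z} → 1 ≤ z → z ≤ n → z ∈ p
    bounded : All (_≤ n) p

first-cars-arrangement : ∀ {t as ss} → length as ≡ suc t → All (1 ≤_) as →
  runFrom t (suc t) [] as ≡ just ss →
  Arrangement (suc t) ss × Pointwise _≤_ as ss
first-cars-arrangement {t} {as} {ss} length≡ 1≤as run
  with _ , unique , as≤ss , ss≤n ← runFrom-before-departures as (≤-reflexive length≡) run
  = record { length≡ = ss-length ; unique = unique ; covers = covers ; bounded = ss≤n } , as≤ss
  where
  ss-length : length ss ≡ suc t
  ss-length = trans (sym (Pointwise.Pointwise-length as≤ss)) length≡
  1≤ss : All (1 ≤_) ss
  1≤ss = Pointwise.All-resp-Pointwise (λ a≤s 1≤a → ≤-trans 1≤a a≤s) as≤ss 1≤as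
  covers : ∀ {z} → 1 ≤ z → z ≤ suc t → z ∈ ss
  covers = unique-bounded-covers unique (All.zip (1≤ss , ss≤n)) ss-length

count≥ : ℕ → List ℕ → ℕ
count≥ c xs = length (filter (c ≤?_) xs)

count≥-∷ : ∀ c x xs → count≥ c xs ≤ count≥ c (x ∷ xs)
count≥-∷ c x xs with c ≤? x
... | yes c≤x rewrite filter-accept (c ≤?_) {x} {xs} c≤x = n≤1+n _
... | no c≰x rewrite filter-reject (c ≤?_) {x} {xs} c≰x = ≤-refl

count≥-mono : ∀ c {as ss} → Pointwise _≤_ as ss → count≥ c as ≤ count≥ c ss
count≥-mono c [] = z≤n
count≥-mono c {a ∷ as} {s ∷ ss} (a≤s ∷ as≤ss) with c ≤? a | c ≤? s
... | yes c≤a | yes c≤s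
  rewrite filter-accept (c ≤?_) {a} {as} c≤a | filter-accept (c ≤?_) {s} {ss} c≤s =
  s≤s (count≥-mono c as≤ss)
... | yes c≤a | no c≰s = ⊥-elim (c≰s (≤-trans c≤a a≤s))
... | no c≰a | _
  rewrite filter-reject (c ≤?_) {a} {as} c≰a = ≤-trans (count≥-mono c as≤ss) (count≥-∷ c s ss)

count≥-↭ : ∀ c {xs ys} → xs ↭ ys → count≥ c xs ≡ count≥ c ys
count≥-↭ c xs↭ys = ↭-length (filter-↭ (c ≤?_) xs↭ys)

count≥-sorted : ∀ c xs → Linked _≤_ xs → (i : Fin (length xs)) → c ≤ Data.List.lookup xs i →
  length xs ∸ toℕ i ≤ count≥ c xs
count≥-sorted c (x ∷ xs) sorted fzero c≤x =
  ≤-reflexive (sym (cong length (filter-all (c ≤?_) (c≤x ∷ c≤xs sorted))))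
  where
  c≤xs : Linked _≤_ (x ∷ xs) → All (c ≤_) xs
  c≤xs [-] = []
  c≤xs (x≤y ∷ sorted) = Linked⇒All ≤-trans (≤-trans c≤x x≤y) sorted
count≥-sorted c (x ∷ xs) sorted (fsuc i) c≤xᵢ =
  ≤-trans (count≥-sorted c xs (Linked.tail sorted) i c≤xᵢ) (count≥-∷ c x xs)

count≥-unique : ∀ n c {xs} → Unique xs → All (_≤ n) xs → count≥ c xs ≤ suc n ∸ c
count≥-unique n c {xs} unique xs≤n = unique-bounded⇒length≤ (Unique.filter⁺ (c ≤?_) unique)
  (All.zip (All.all-filter (c ≤?_) xs , All.filter⁺ (c ≤?_) xs≤n))

sorted-bounded-by-index : ∀ {n as ss} → length as ≡ n → Pointwise _≤_ as ss →
  Unique ss → All (_≤ n) ss →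
  ∀ (i : Fin (length (sortℕ as))) → Data.List.lookup (sortℕ as) i ≤ suc (toℕ i)
sorted-bounded-by-index {n} {as} {ss} length≡ as≤ss unique ss≤n i =
  ≮⇒≥ λ 1+i<aᵢ → <-irrefl refl (begin-strict
  n ∸ suc (toℕ i)          <⟨ ∸-monoʳ-< (n<1+n (toℕ i)) i<n ⟩
  n ∸ toℕ i                ≡⟨ cong (_∸ toℕ i) sorted-length ⟨
  length sorted ∸ toℕ i    ≤⟨ count≥-sorted c sorted (sort-↗ as) i 1+i<aᵢ ⟩
  count≥ c sorted          ≡⟨ count≥-↭ c (sort-↭ as) ⟩
  count≥ c as              ≤⟨ count≥-mono c as≤ss ⟩
  count≥ c ss              ≤⟨ count≥-unique n c unique ss≤n ⟩
  n ∸ suc (toℕ i)          ∎)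
  where
  open ≤-Reasoning
  c : ℕ
  c = suc (suc (toℕ i))
  sorted : List ℕ
  sorted = sortℕ as
  sorted-length : length sorted ≡ n
  sorted-length = trans (↭-length (sort-↭ as)) length≡
  i<n : toℕ i < n
  i<n = subst (toℕ i <_) sorted-length (toℕ<n i)

module _ {A : Set} where

  rotate : List A → List A
  rotate [] = []
  rotate (x ∷ xs) = xs ∷ʳ x

  rotateBy : ℕ → List A → List A
  rotateBy zero xs = xs
  rotateBy (suc j) xs = rotate (rotateBy j xs)

  rotateBy-+ : ∀ i j xs → rotateBy (i + j) xs ≡ rotateBy i (rotateBy j xs)
  rotateBy-+ zero j xs = refl
  rotateBy-+ (suc i) j xs = cong rotate (rotateBy-+ i j xs)

  rotateBy-suc : ∀ j xs → rotateBy (suc j) xs ≡ rotateBy j (rotate xs)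
  rotateBy-suc j xs = trans (cong (λ k → rotateBy k xs) (+-comm 1 j)) (rotateBy-+ j 1 xs)

  length-rotate : ∀ xs → length (rotate xs) ≡ length xs
  length-rotate [] = refl
  length-rotate (x ∷ xs) = trans (length-++ xs) (+-comm (length xs) 1)

  take-++ˡ : ∀ j (xs ys : List A) → j ≤ length xs → List.take j (xs ++ ys) ≡ List.take j xs
  take-++ˡ zero xs ys _ = refl
  take-++ˡ (suc j) (x ∷ xs) ys (s≤s j≤xs) = cong (x ∷_) (take-++ˡ j xs ys j≤xs)

  drop-++ˡ : ∀ j (xs ys : List A) → j ≤ length xs → List.drop j (xs ++ ys) ≡ List.drop j xs ++ ys
  drop-++ˡ zero xs ys _ = refl
  drop-++ˡ (suc j) (x ∷ xs) ys (s≤s j≤xs) = drop-++ˡ j xs ys j≤xs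

  rotateBy-split : ∀ j xs → j ≤ length xs → rotateBy j xs ≡ List.drop j xs ++ List.take j xs
  rotateBy-split zero xs _ = sym (++-identityʳ xs)
  rotateBy-split (suc j) (x ∷ xs) (s≤s j≤xs) = begin
    rotateBy (suc j) (x ∷ xs)
      ≡⟨ rotateBy-suc j (x ∷ xs) ⟩
    rotateBy j (xs ∷ʳ x)
      ≡⟨ rotateBy-split j (xs ∷ʳ x) j≤xs∷ʳx ⟩
    List.drop j (xs ∷ʳ x) ++ List.take j (xs ∷ʳ x)
      ≡⟨ cong₂ _++_ (drop-++ˡ j xs [ x ] j≤xs) (take-++ˡ j xs [ x ] j≤xs) ⟩
    (List.drop j xs ∷ʳ x) ++ List.take j xs
      ≡⟨ ++-assoc (List.drop j xs) [ x ] (List.take j xs) ⟩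
    List.drop j xs ++ List.take (suc j) (x ∷ xs)
      ∎
    where
    open ≡-Reasoning
    j≤xs∷ʳx : j ≤ length (xs ∷ʳ x)
    j≤xs∷ʳx = ≤-trans j≤xs (≤-trans (n≤1+n _) (≤-reflexive (sym (length-rotate (x ∷ xs)))))

  rotateBy-length : ∀ xs → rotateBy (length xs) xs ≡ xs
  rotateBy-length xs = begin
    rotateBy (length xs) xs
      ≡⟨ rotateBy-split (length xs) xs ≤-refl ⟩
    List.drop (length xs) xs ++ List.take (length xs) xs
      ≡⟨ cong₂ _++_ (drop-all _ xs ≤-refl) (take-all _ xs ≤-refl) ⟩
    xs
      ∎
    where open ≡-Reasoning

  rotateBy-multiple : ∀ c xs → rotateBy (c * length xs) xs ≡ xs
  rotateBy-multiple zero xs = refl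
  rotateBy-multiple (suc c) xs = begin
    rotateBy (length xs + c * length xs) xs
      ≡⟨ rotateBy-+ (length xs) (c * length xs) xs ⟩
    rotateBy (length xs) (rotateBy (c * length xs) xs)
      ≡⟨ cong (rotateBy (length xs)) (rotateBy-multiple c xs) ⟩
    rotateBy (length xs) xs
      ≡⟨ rotateBy-length xs ⟩
    xs
      ∎
    where open ≡-Reasoning

  rotateBy-% : ∀ {n} .{{_ : NonZero n}} j xs → length xs ≡ n → rotateBy j xs ≡ rotateBy (j % n) xs
  rotateBy-% j xs refl = begin
    rotateBy j xs
      ≡⟨ cong (λ k → rotateBy k xs) (m≡m%n+[m/n]*n j (length xs)) ⟩
    rotateBy (j % length xs + j / length xs * length xs) xs
      ≡⟨ rotateBy-+ (j % length xs) _ xs ⟩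
    rotateBy (j % length xs) (rotateBy (j / length xs * length xs) xs)
      ≡⟨ cong (rotateBy (j % length xs)) (rotateBy-multiple (j / length xs) xs) ⟩
    rotateBy (j % length xs) xs
      ∎
    where open ≡-Reasoning

  head-drop-toList : ∀ {n} (v : Vec A n) (i : Fin n) ys →
    List.head (List.drop (toℕ i) (toList v) ++ ys) ≡ just (lookup v i)
  head-drop-toList (x ∷ v) fzero ys = refl
  head-drop-toList (x ∷ v) (fsuc i) ys = head-drop-toList v i ys

  head-rotateBy : ∀ {n} .{{_ : NonZero n}} (π : Vec A n) j →
    List.head (rotateBy j (toList π)) ≡ just (lookup π (j mod n))
  head-rotateBy {n} π j = begin
    List.head (rotateBy j (toList π))
      ≡⟨ cong List.head (rotateBy-% j (toList π) (Vec.length-toList π)) ⟩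
    List.head (rotateBy (j % n) (toList π))
      ≡⟨ cong (λ r → List.head (rotateBy r (toList π))) r≡j%n ⟨
    List.head (rotateBy r (toList π))
      ≡⟨ cong List.head (rotateBy-split r (toList π) r≤length) ⟩
    List.head (List.drop r (toList π) ++ List.take r (toList π))
      ≡⟨ head-drop-toList π (j mod n) _ ⟩
    just (lookup π (j mod n))
      ∎
    where
    open ≡-Reasoning
    r : ℕ
    r = toℕ (j mod n)
    r≡j%n : r ≡ j % n
    r≡j%n = toℕ-fromℕ< (m%n<n j n)
    r≤length : r ≤ length (toList π)
    r≤length = subst (r ≤_) (sym (Vec.length-toList π)) (<⇒≤ (toℕ<n (j mod n)))

∈-rotate⁺ : ∀ {A : Set} {v : A} {xs} → v ∈ xs → v ∈ rotate xs
∈-rotate⁺ {xs = x ∷ xs} (here refl) = ∈-++⁺ʳ xs (here refl)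
∈-rotate⁺ (there v∈xs) = ∈-++⁺ˡ v∈xs

rotate-arrangement : ∀ {n xs} → Arrangement n xs → Arrangement n (rotate xs)
rotate-arrangement {xs = []} arr = arr
rotate-arrangement {n} {x ∷ xs} arr = record
  { length≡ = trans (length-rotate (x ∷ xs)) length≡
  ; unique = Unique.++⁺ (AllPairs.tail unique) ([] ∷ [])
               λ { (v∈xs , here v≡x) → All.lookup (AllPairs.head unique) v∈xs (sym v≡x) }
  ; covers = λ 1≤z z≤n → ∈-rotate⁺ (covers 1≤z z≤n)
  ; bounded = All.++⁺ (All.tail bounded) (All.head bounded ∷ [])
  }
  where open Arrangement arr

rotateBy-arrangement : ∀ {n xs} → Arrangement n xs → ∀ j → Arrangement n (rotateBy j xs)
rotateBy-arrangement arr zero = arr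
rotateBy-arrangement arr (suc j) = rotate-arrangement (rotateBy-arrangement arr j)

module _ {t : ℕ} where

  ParksFrom : List ℕ → List ℕ → Set
  ParksFrom hist cars = Parks (runFrom t (suc t) hist cars)

  queue-step : ∀ {x q h b bs} → Arrangement (suc t) (x ∷ q) → 1 ≤ b →
    ParksFrom ((x ∷ q) ʳ++ h) (b ∷ bs) ⇔ (b ≤ x × ParksFrom (rotate (x ∷ q) ʳ++ (x ∷ h)) bs)
  queue-step {x} {q} {h} {b} {bs} arr 1≤b = from-firstFree (firstFree (suc t) occupied b) refl
    where
    open Arrangement arr
    hist occupied : List ℕ
    hist = (x ∷ q) ʳ++ h
    occupied = List.take t hist
    occupied≡ : occupied ≡ reverse q
    occupied≡ = begin
      List.take t hist
        ≡⟨ cong₂ List.take (sym (trans (length-reverse q) (suc-injective length≡))) (ʳ++-defn q) ⟩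
      List.take (length (reverse q)) (reverse q ++ x ∷ h)
        ≡⟨ take-++ˡ _ (reverse q) (x ∷ h) ≤-refl ⟩
      List.take (length (reverse q)) (reverse q)
        ≡⟨ take-all _ (reverse q) ≤-refl ⟩
      reverse q
        ∎
      where open ≡-Reasoning
    q⊆occupied : q ⊆ occupied
    q⊆occupied v∈q = subst (_ ∈_) (sym occupied≡) (Any.reverse⁺ v∈q)
    x∉occupied : x ∉ occupied
    x∉occupied x∈occupied =
      All.lookup (AllPairs.head unique) (Any.reverse⁻ (subst (x ∈_) occupied≡ x∈occupied)) refl
    from-firstFree : ∀ m → firstFree (suc t) occupied b ≡ m →
      ParksFrom hist (b ∷ bs) ⇔ (b ≤ x × ParksFrom (rotate (x ∷ q) ʳ++ (x ∷ h)) bs)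
    from-firstFree nothing full = mk⇔ (⊥-elim ∘ parks-∷-nothing {hist = hist} {b} {bs} full)
      λ (b≤x , _) → ⊥-elim (x∉occupied (firstFree-nothing full b≤x (All.head bounded)))
    from-firstFree (just s) free with firstFree-just free
    ... | b≤s , s≤n , s∉occupied with covers (≤-trans 1≤b b≤s) s≤n
    ...   | there s∈q = ⊥-elim (s∉occupied (q⊆occupied s∈q))
    ...   | here refl = mk⇔ (λ p → b≤s , Equivalence.to parks-after p) (Equivalence.from parks-after ∘ proj₂)
      where
      parks-after : ParksFrom hist (b ∷ bs) ⇔ ParksFrom (rotate (x ∷ q) ʳ++ (x ∷ h)) bs
      parks-after = subst (λ hist′ → ParksFrom hist (b ∷ bs) ⇔ ParksFrom hist′ bs) (sym (++-ʳ++ q))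
        (parks-∷-just {hist = hist} {b} {bs} free)

  -- The queue rotateBy j π lists the spots of the last t + 1 cars, oldest first.
  cyclic-phase : ∀ (π : Vec ℕ (suc t)) → Arrangement (suc t) (toList π) →
    ∀ j h {m} (β : Vec ℕ m) → All (1 ≤_) (toList β) →
    ParksFrom (rotateBy j (toList π) ʳ++ h) (toList β) ⇔
      (∀ i → lookup β i ≤ lookup π ((j + toℕ i) mod suc t))
  cyclic-phase π arr j h [] _ = mk⇔ (λ _ ()) (λ _ → parks [])
  cyclic-phase π arr j h (b ∷ β) (1≤b ∷ 1≤β)
    with rotateBy j (toList π) in queue≡ | head-rotateBy π j | rotateBy-arrangement arr j
  ... | x ∷ q | refl | arrⱼ = begin
    ParksFrom ((x ∷ q) ʳ++ h) (b ∷ toList β)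
      ≈⟨ queue-step arrⱼ 1≤b ⟩
    (b ≤ x × ParksFrom (rotate (x ∷ q) ʳ++ (x ∷ h)) (toList β))
      ≡⟨ cong (λ queue → b ≤ x × ParksFrom (rotate queue ʳ++ (x ∷ h)) (toList β)) queue≡ ⟨
    (b ≤ x × ParksFrom (rotateBy (suc j) (toList π) ʳ++ (x ∷ h)) (toList β))
      ≈⟨ ⇔-refl ×-⇔ cyclic-phase π arr (suc j) (x ∷ h) β 1≤β ⟩
    (b ≤ x × (∀ i → lookup β i ≤ bound (suc j + toℕ i)))
      ≈⟨ mk⇔ (λ (b≤x , β≤) → λ
                { fzero → subst (b ≤_) (sym (cong bound (+-identityʳ j))) b≤x
                ; (fsuc i) → subst (lookup β i ≤_) (sym (cong bound (+-suc j (toℕ i)))) (β≤ i) })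
             (λ ≤bound → subst (b ≤_) (cong bound (+-identityʳ j)) (≤bound fzero)
                       , λ i → subst (lookup β i ≤_) (cong bound (+-suc j (toℕ i))) (≤bound (fsuc i))) ⟩
    (∀ i → lookup (b ∷ β) i ≤ bound (j + toℕ i))
      ∎
    where
    open SetoidReasoning (⇔-setoid 0ℓ)
    bound : ℕ → ℕ
    bound k = lookup π (k mod suc t)

  metered-parking-criterion : ∀ {k} as (β : Vec ℕ k) →
    length as ≡ suc t → All (1 ≤_) as → All (1 ≤_) (toList β) →
    ParksFrom [] (as ++ toList β) ⇔
      ((∀ (i : Fin (length (sortℕ as))) → Data.List.lookup (sortℕ as) i ≤ suc (toℕ i))
       × ∃ λ (π : Vec ℕ (suc t)) → runFrom t (suc t) [] as ≡ just (toList π)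
           × (∀ (i : Fin k) → lookup β i ≤ lookup π (toℕ i mod suc t)))
  metered-parking-criterion {k} as β as-length 1≤as 1≤β = mk⇔ forward (backward ∘ proj₂)
    where
    Later : Vec ℕ (suc t) → Set
    Later π = ∀ (i : Fin k) → lookup β i ≤ lookup π (toℕ i mod suc t)
    Outcome : Vec ℕ (suc t) → Set
    Outcome π = runFrom t (suc t) [] as ≡ just (toList π)
    phases : ∀ π → Outcome π → ParksFrom [] (as ++ toList β) ⇔ Later π
    phases π run = ⇔-trans (parks-++ as (toList β) run)
      (cyclic-phase π (proj₁ (first-cars-arrangement as-length 1≤as run)) 0 [] β 1≤β)
    forward : ParksFrom [] (as ++ toList β) →
      (∀ i → Data.List.lookup (sortℕ as) i ≤ suc (toℕ i)) × ∃ λ π → Outcome π × Later π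
    forward parks-all with ss , run ← parks-++⁻ as (toList β) parks-all =
      sorted-bounded-by-index as-length as≤ss unique bounded
      , π , run′ , Equivalence.to (phases π run′) parks-all
      where
      arr : Arrangement (suc t) ss
      arr = proj₁ (first-cars-arrangement as-length 1≤as run)
      as≤ss : Pointwise _≤_ as ss
      as≤ss = proj₂ (first-cars-arrangement as-length 1≤as run)
      open Arrangement arr using (length≡; unique; bounded)
      π : Vec ℕ (suc t)
      π = Vec.cast length≡ (Vec.fromList ss)
      toList-π : toList π ≡ ss
      toList-π = trans (Vec.toList-cast length≡ (Vec.fromList ss)) (Vec.toList∘fromList ss)
      run′ : Outcome π
      run′ = trans run (cong just (sym toList-π))
    backward : (∃ λ π → Outcome π × Later π) → ParksFrom [] (as ++ toList β)
    backward (π , run , β≤π) = Equivalence.from (phases π run) β≤π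

theorem5p2 : (n k : ℕ) → .{{_ : NonZero n}} → 1 ≤ k →
    (α : Vec ℕ (n + k)) → All (λ a → 1 ≤ a × a ≤ n) (toList α) →
    IsMeteredPF (n ∸ 1) n (toList α) ⇔
      ((∀ (i : Fin (length (sortℕ (toList (take n α))))) →
          Data.List.lookup (sortℕ (toList (take n α))) i ≤ suc (toℕ i))
       × ∃ λ (π : Vec ℕ n) → outcome (n ∸ 1) n (toList (take n α)) ≡ just (toList π)
           × (∀ (i : Fin k) → lookup α (n ↑ʳ i) ≤ lookup π (toℕ i mod n)))
theorem5p2 n@(suc t) k _ α bounds = mk⇔
  (λ (_ , parks-α) →
     let sorted , π , run , later = to (subst (ParksFrom []) α-split parks-α)
     in sorted , π , run , λ i → subst (_≤ lookup π (toℕ i mod n)) (sym (lookup-drop i)) (later i))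
  (λ (sorted , π , run , later) →
     bounds , subst (ParksFrom []) (sym α-split)
                (from (sorted , π , run , λ i → subst (_≤ lookup π (toℕ i mod n)) (lookup-drop i) (later i))))
  where
  as : List ℕ
  as = toList (take n α)
  β : Vec ℕ k
  β = Vec.drop n α
  α-split : toList α ≡ as ++ toList β
  α-split = trans (cong toList (sym (Vec.take++drop≡id n α))) (Vec.toList-++ (take n α) β)
  lookup-drop : ∀ i → lookup α (n ↑ʳ i) ≡ lookup β i
  lookup-drop i = trans (cong (λ v → lookup v (n ↑ʳ i)) (sym (Vec.take++drop≡id n α)))
    (Vec.lookup-++ʳ (take n α) β i)
  1≤α : All (1 ≤_) (as ++ toList β)
  1≤α = All.map proj₁ (subst (All _) α-split bounds)
  as-length : length as ≡ n
  as-length = Vec.length-toList (take n α)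
  1≤as : All (1 ≤_) as
  1≤as = All.++⁻ˡ as 1≤α
  1≤β : All (1 ≤_) (toList β)
  1≤β = All.++⁻ʳ as 1≤α
  open Equivalence (metered-parking-criterion as β as-length 1≤as 1≤β) using (to; from)
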